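{- Let $n$ be a positive integer and $X$ a nonempty set of Latin squares of order $n$ that is closed under symbol permutation (i.e. if $L\in X$ and $\sigma$ is any bijection of $[1,n]$, then $\sigma(L)\in X$). If $m$ is the maximum inner distance of the squares in $X$, then for every $k\in[1,m]$ there exists a square in $X$ of inner distance $k$.
   Context: A Latin square of order $n$ is an $n\times n$ matrix with entries $m_{i,j}\in[1,n]$ such that every row and column contains each symbol exactly once. For a bijection $\sigma$ of $[1,n]$, $\sigma(L)$ is the Latin square with entries $\sigma(m_{i,j})$. Cells are adjacent if they share a horizontal or vertical edge. For $a,b\in[1,n]$, $\mathrm{dist}(a,b)$ is the minimum of the residues in $[0,n-1]$ of $a-b$ and $b-a$ modulo $n$. The inner distance of a Latin square is the minimum of $\mathrm{dist}$ over all pairs of symbols in adjacent cells. -}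

module Defs where

open import Data.Nat using (ℕ; _≤_; _⊓_; _∸_; ∣_-_∣)
open import Data.Fin using (Fin; toℕ)
open import Data.Product using (_×_; _,_; proj₁; proj₂; ∃; ∃-syntax; Σ-syntax)
open import Data.Sum using (_⊎_)
open import Relation.Binary.PropositionalEquality using (_≡_)
open import Function.Bundles using (Bijection; _⤖_)
open import Function.Definitions using (Bijective)

-- An n×n matrix with symbols in Fin n (symbol s ∈ Fin n stands for s+1 ∈ [1,n]).
Matrix : ℕ → Set
Matrix n = Fin n → Fin n → Fin n

IsLatin : {n : ℕ} → Matrix n → Set
IsLatin {n} M = (∀ i → Bijective _≡_ _≡_ (λ j → M i j))
              × (∀ j → Bijective _≡_ _≡_ (λ i → M i j))

applySym : {n : ℕ} → (Fin n ⤖ Fin n) → Matrix n → Matrix n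
applySym σ M i j = Bijection.to σ (M i j)

Next : {n : ℕ} → Fin n → Fin n → Set
Next a b = toℕ b ≡ Data.Nat.suc (toℕ a)

Adjacent : {n : ℕ} → (Fin n × Fin n) → (Fin n × Fin n) → Set
Adjacent (i , j) (i' , j') =
  (i ≡ i' × (Next j j' ⊎ Next j' j)) ⊎ (j ≡ j' × (Next i i' ⊎ Next i' i))

-- dist(a,b) = min of residues of a-b and b-a mod n.
dist : (n : ℕ) → Fin n → Fin n → ℕ
dist n a b = ∣ toℕ a - toℕ b ∣ ⊓ (n ∸ ∣ toℕ a - toℕ b ∣)

InnerDist : {n : ℕ} → Matrix n → ℕ → Set
InnerDist {n} M d =
  (∃[ p ] ∃[ q ] (Adjacent p q × dist n (M (proj₁ p) (proj₂ p)) (M (proj₁ q) (proj₂ q)) ≡ d))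
  × (∀ p q → Adjacent p q → d ≤ dist n (M (proj₁ p) (proj₂ p)) (M (proj₁ q) (proj₂ q)))

{-# OPTIONS --safe #-}
module Submission where

open import Defs
open import Data.Nat using (ℕ; zero; suc; _+_; _∸_; _⊓_; _≤_; _<_; z≤n; s≤s; ∣_-_∣)
open import Data.Nat.Properties
open import Data.Fin using (Fin; toℕ; fromℕ<)
open import Data.Fin.Properties using (toℕ<n; toℕ-fromℕ<; any?) renaming (_≟_ to _≟ᶠ_)
open import Data.Fin.Permutation using (transpose)
import Data.Fin.Permutation.Components as PC
open import Data.Product using (_×_; _,_; proj₁; proj₂; ∃; ∃-syntax)
open import Data.Sum using (_⊎_; inj₁; inj₂; swap)
open import Data.Empty using (⊥-elim)
open import Function.Bundles using (_⤖_)
open import Function.Properties.Inverse using (↔⇒⤖)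
open import Relation.Nullary using (Dec; yes; no)
open import Relation.Nullary.Decidable using (map′; _×-dec_; _⊎-dec_)
open import Relation.Binary using (tri<; tri≈; tri>)
open import Relation.Binary.PropositionalEquality

-- Starting from a square of inner distance m ≥ k and an adjacent pair of
-- cells holding symbols a < b, repeatedly exchange the symbol b with b - 1.
-- Such a transposition of consecutive symbols moves every difference
-- |x - y| by at most one, hence changes every dist, and with it the inner
-- distance, by at most one; and it lowers the gap b - a by one. So the
-- inner distance cannot jump over k before the gap reaches 1, where the
-- pair itself has dist 1.

transpose-matchʳ : ∀ {n} (i j : Fin n) → PC.transpose i j j ≡ i
transpose-matchʳ i j with j ≟ᶠ i
... | yes j≡i = j≡i
... | no _ with j ≟ᶠ j
...   | yes _ = refl
...   | no j≢j = ⊥-elim (j≢j refl)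

transpose-other : ∀ {n} {i j k : Fin n} → k ≢ i → k ≢ j → PC.transpose i j k ≡ k
transpose-other {i = i} {j} {k} k≢i k≢j with k ≟ᶠ i
... | yes k≡i = ⊥-elim (k≢i k≡i)
... | no _ with k ≟ᶠ j
...   | yes k≡j = ⊥-elim (k≢j k≡j)
...   | no _ = refl

Window : ℕ → ℕ → Set
Window c x = x ≡ c ⊎ x ≡ suc c

MovesWithin : ℕ → ℕ → ℕ → Set
MovesWithin c x x′ = x ≡ x′ ⊎ (Window c x × Window c x′)

movesWithin-sym : ∀ {c x x′} → MovesWithin c x x′ → MovesWithin c x′ x
movesWithin-sym (inj₁ x≡x′)   = inj₁ (sym x≡x′)
movesWithin-sym (inj₂ (w , w′)) = inj₂ (w′ , w)

∣n-1+n∣≡1 : ∀ n → ∣ n - suc n ∣ ≡ 1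
∣n-1+n∣≡1 zero    = refl
∣n-1+n∣≡1 (suc n) = ∣n-1+n∣≡1 n

∣-∣-window : ∀ {c x y} → Window c x → Window c y → ∣ x - y ∣ ≤ 1
∣-∣-window {c} (inj₁ refl) (inj₁ refl) = ≤-trans (≤-reflexive (∣n-n∣≡0 c)) z≤n
∣-∣-window {c} (inj₁ refl) (inj₂ refl) = ≤-reflexive (∣n-1+n∣≡1 c)
∣-∣-window {c} (inj₂ refl) (inj₁ refl) = ≤-reflexive (trans (∣-∣-comm (suc c) c) (∣n-1+n∣≡1 c))
∣-∣-window {c} (inj₂ refl) (inj₂ refl) = ≤-trans (≤-reflexive (∣n-n∣≡0 (suc c))) z≤n

∣-∣-displacement : ∀ {c x x′} → MovesWithin c x x′ → ∣ x - x′ ∣ ≤ 1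
∣-∣-displacement {x = x} (inj₁ refl) = ≤-trans (≤-reflexive (∣n-n∣≡0 x)) z≤n
∣-∣-displacement (inj₂ (w , w′))     = ∣-∣-window w w′

∣-∣-moveʳ : ∀ {c} x {y y′} → MovesWithin c y y′ → ∣ x - y ∣ ≤ suc ∣ x - y′ ∣
∣-∣-moveʳ x {y} {y′} m = begin
  ∣ x - y ∣                  ≡⟨ ∣-∣-comm x y ⟩
  ∣ y - x ∣                  ≤⟨ ∣-∣-triangle y y′ x ⟩
  ∣ y - y′ ∣ + ∣ y′ - x ∣    ≤⟨ +-monoˡ-≤ ∣ y′ - x ∣ (∣-∣-displacement m) ⟩
  suc ∣ y′ - x ∣             ≡⟨ cong suc (∣-∣-comm y′ x) ⟩
  suc ∣ x - y′ ∣             ∎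
  where open ≤-Reasoning

∣-∣-movesWithin : ∀ {c x x′ y y′} → MovesWithin c x x′ → MovesWithin c y y′ →
                  ∣ x - y ∣ ≤ suc ∣ x′ - y′ ∣
∣-∣-movesWithin {x = x} (inj₁ refl) my = ∣-∣-moveʳ x my
∣-∣-movesWithin {x = x} {x′} {y} mx (inj₁ refl) = begin
  ∣ x - y ∣       ≡⟨ ∣-∣-comm x y ⟩
  ∣ y - x ∣       ≤⟨ ∣-∣-moveʳ y mx ⟩
  suc ∣ y - x′ ∣  ≡⟨ cong suc (∣-∣-comm y x′) ⟩
  suc ∣ x′ - y ∣  ∎
  where open ≤-Reasoning
∣-∣-movesWithin (inj₂ (wx , _)) (inj₂ (wy , _)) = ≤-trans (∣-∣-window wx wy) (s≤s z≤n)

⊓-∸-≤-suc : ∀ n {D D′} → D ≤ suc D′ → D′ ≤ suc D → D ⊓ (n ∸ D) ≤ suc (D′ ⊓ (n ∸ D′))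
⊓-∸-≤-suc n {D} {D′} D≤1+D′ D′≤1+D = ⊓-mono-≤ D≤1+D′ (m≤n+o⇒m∸n≤o n D n≤D+1+[n∸D′])
  where
  open ≤-Reasoning
  n≤D+1+[n∸D′] : n ≤ D + suc (n ∸ D′)
  n≤D+1+[n∸D′] = begin
    n                  ≤⟨ m≤n+m∸n n D′ ⟩
    D′ + (n ∸ D′)      ≤⟨ +-monoˡ-≤ (n ∸ D′) D′≤1+D ⟩
    suc D + (n ∸ D′)   ≡⟨ +-suc D (n ∸ D′) ⟨
    D + suc (n ∸ D′)   ∎

dist-≡-0 : ∀ n {a b : Fin n} → toℕ a ≡ toℕ b → dist n a b ≡ 0
dist-≡-0 n {b = b} eq rewrite eq | ∣n-n∣≡0 (toℕ b) = refl

dist-positive⇒distinct : ∀ n {a b : Fin n} → 1 ≤ dist n a b → toℕ a ≢ toℕ b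
dist-positive⇒distinct n 1≤d eq = <-irrefl refl (≤-trans 1≤d (≤-reflexive (dist-≡-0 n eq)))

dist-consecutive : ∀ n {a b : Fin n} → toℕ b ≡ suc (toℕ a) → dist n a b ≡ 1
dist-consecutive n {a} {b} b≡1+a rewrite b≡1+a | ∣n-1+n∣≡1 (toℕ a) = m≤n⇒m⊓n≡m (∸-monoˡ-≤ 1 2≤n)
  where
  2≤n : 2 ≤ n
  2≤n = ≤-trans (s≤s (s≤s z≤n)) (subst (_< n) b≡1+a (toℕ<n b))

module _ {n : ℕ} {c d : Fin n} (d≡1+c : toℕ d ≡ suc (toℕ c)) where

  transpose-movesWithin : ∀ x → MovesWithin (toℕ c) (toℕ x) (toℕ (PC.transpose c d x))
  transpose-movesWithin x with x ≟ᶠ c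
  ... | yes refl = inj₂ (inj₁ refl , inj₂ d≡1+c)
  ... | no _ with x ≟ᶠ d
  ...   | yes refl = inj₂ (inj₂ d≡1+c , inj₁ refl)
  ...   | no _ = inj₁ refl

  dist-≤-transpose : ∀ a b → dist n a b ≤ suc (dist n (PC.transpose c d a) (PC.transpose c d b))
  dist-≤-transpose a b = ⊓-∸-≤-suc n
    (∣-∣-movesWithin (transpose-movesWithin a) (transpose-movesWithin b))
    (∣-∣-movesWithin (movesWithin-sym (transpose-movesWithin a)) (movesWithin-sym (transpose-movesWithin b)))

<⇒gap : ∀ {x y} → x < y → ∃[ g ] y ≡ suc (g + x)
<⇒gap {x} x<y with m≤n⇒∃[o]m+o≡n x<y
... | g , 1+x+g≡y = g , trans (sym 1+x+g≡y) (cong suc (+-comm x g))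

gap-between : ∀ {x y} → x ≢ y → (∃[ g ] y ≡ suc (g + x)) ⊎ (∃[ g ] x ≡ suc (g + y))
gap-between {x} {y} x≢y with <-cmp x y
... | tri< x<y _ _ = inj₁ (<⇒gap x<y)
... | tri≈ _ x≡y _ = ⊥-elim (x≢y x≡y)
... | tri> _ _ y<x = inj₂ (<⇒gap y<x)

module _ {n : ℕ} where

  at : Matrix n → Fin n × Fin n → Fin n
  at L p = L (proj₁ p) (proj₂ p)

  InnerDistAtLeast : ℕ → Matrix n → Set
  InnerDistAtLeast k L = ∀ p q → Adjacent p q → k ≤ dist n (at L p) (at L q)

  HasAdjacentBelow : ℕ → Matrix n → Set
  HasAdjacentBelow k L = ∃[ p ] ∃[ q ] (Adjacent p q × dist n (at L p) (at L q) < k)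

  adjacent-sym : ∀ {p q : Fin n × Fin n} → Adjacent p q → Adjacent q p
  adjacent-sym (inj₁ (i≡i′ , next)) = inj₁ (sym i≡i′ , swap next)
  adjacent-sym (inj₂ (j≡j′ , next)) = inj₂ (sym j≡j′ , swap next)

  adjacent? : ∀ (p q : Fin n × Fin n) → Dec (Adjacent p q)
  adjacent? (i , j) (i′ , j′) =
    ((i ≟ᶠ i′) ×-dec ((toℕ j′ ≟ suc (toℕ j)) ⊎-dec (toℕ j ≟ suc (toℕ j′))))
    ⊎-dec ((j ≟ᶠ j′) ×-dec ((toℕ i′ ≟ suc (toℕ i)) ⊎-dec (toℕ i ≟ suc (toℕ i′))))

  anyCell? : ∀ {P : Fin n × Fin n → Set} → (∀ p → Dec (P p)) → Dec (∃ P)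
  anyCell? P? = map′ (λ (i , j , Pij) → (i , j) , Pij) (λ ((i , j) , Pij) → i , j , Pij)
                     (any? λ i → any? λ j → P? (i , j))

  atLeast-or-below : ∀ k (L : Matrix n) → InnerDistAtLeast k L ⊎ HasAdjacentBelow k L
  atLeast-or-below k L with anyCell? (λ p → anyCell? λ q → adjacent? p q ×-dec (dist n (at L p) (at L q) <? k))
  ... | yes below = inj₂ below
  ... | no ¬below = inj₁ λ p q adj → ≮⇒≥ λ d<k → ¬below (p , q , adj , d<k)

  innerDistAtLeast-weaken : ∀ {k m} (L : Matrix n) → k ≤ m → InnerDistAtLeast m L → InnerDistAtLeast k L
  innerDistAtLeast-weaken _ k≤m atLeast p q adj = ≤-trans k≤m (atLeast p q adj)

  innerDist-attained : ∀ {k} (L : Matrix n) → InnerDistAtLeast k L →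
                       ∀ p q → Adjacent p q → dist n (at L p) (at L q) ≤ k → InnerDist L k
  innerDist-attained _ atLeast p q adj d≤k = (p , q , adj , ≤-antisym d≤k (atLeast p q adj)) , atLeast

module Descent {n : ℕ} (X : Matrix n → Set)
  (closed : ∀ (σ : Fin n ⤖ Fin n) L → X L → X (applySym σ L))
  {k : ℕ} (1≤k : 1 ≤ k) where

  descend : ∀ g L → X L → InnerDistAtLeast k L →
            ∀ p q → Adjacent p q → toℕ (at L q) ≡ suc (g + toℕ (at L p)) →
            ∃[ L′ ] (X L′ × InnerDist L′ k)
  descend zero L xL atLeast p q adj gap =
    L , xL , innerDist-attained L atLeast p q adj (≤-trans (≤-reflexive (dist-consecutive n gap)) 1≤k)
  descend (suc g) L xL atLeast p q adj gap = continue (atLeast-or-below k L′)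
    where
    a = at L p
    d = at L q
    c<n : suc (g + toℕ a) < n
    c<n = <-trans (subst (suc (g + toℕ a) <_) (sym gap) (n<1+n _)) (toℕ<n d)
    c : Fin n
    c = fromℕ< c<n
    d≡1+c : toℕ d ≡ suc (toℕ c)
    d≡1+c = trans gap (cong suc (sym (toℕ-fromℕ< c<n)))
    σ : Fin n ⤖ Fin n
    σ = ↔⇒⤖ (transpose c d)
    L′ : Matrix n
    L′ = applySym σ L
    a-fixed : at L′ p ≡ a
    a-fixed = transpose-other (λ a≡c → m≢1+n+m (toℕ a) (trans (cong toℕ a≡c) (toℕ-fromℕ< c<n)))
                              (λ a≡d → m≢1+n+m (toℕ a) (trans (cong toℕ a≡d) gap))
    gap′ : toℕ (at L′ q) ≡ suc (g + toℕ (at L′ p))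
    gap′ = begin
      toℕ (at L′ q)           ≡⟨ cong toℕ (transpose-matchʳ c d) ⟩
      toℕ c                   ≡⟨ toℕ-fromℕ< c<n ⟩
      suc (g + toℕ a)         ≡⟨ cong (λ x → suc (g + toℕ x)) a-fixed ⟨
      suc (g + toℕ (at L′ p)) ∎
      where open ≡-Reasoning
    continue : InnerDistAtLeast k L′ ⊎ HasAdjacentBelow k L′ → ∃[ L″ ] (X L″ × InnerDist L″ k)
    continue (inj₁ atLeast′) = descend g L′ (closed σ L xL) atLeast′ p q adj gap′
    continue (inj₂ (u , v , adj′ , below)) =
      L , xL , innerDist-attained L atLeast u v adj′ (≤-trans (dist-≤-transpose d≡1+c (at L u) (at L v)) below)

mainTheorem3 : (n : ℕ) → 1 ≤ n
    → (X : Matrix n → Set)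
    → (∀ L → X L → IsLatin L)
    → (∃[ L ] X L)
    → (∀ (σ : Fin n ⤖ Fin n) L → X L → X (applySym σ L))
    → (m : ℕ)
    → (∃[ L ] (X L × InnerDist L m))
    → (∀ L d → X L → InnerDist L d → d ≤ m)
    → ∀ k → 1 ≤ k → k ≤ m → ∃[ L ] (X L × InnerDist L k)
mainTheorem3 n _ X _ _ closed m (L , xL , (p , q , adj , dist≡m) , minimal) _ k 1≤k k≤m
  with gap-between (dist-positive⇒distinct n (subst (1 ≤_) (sym dist≡m) (≤-trans 1≤k k≤m)))
... | inj₁ (g , gap) = Descent.descend X closed 1≤k g L xL
                         (innerDistAtLeast-weaken L k≤m minimal) p q adj gap
... | inj₂ (g , gap) = Descent.descend X closed 1≤k g L xL
                         (innerDistAtLeast-weaken L k≤m minimal) q p (adjacent-sym adj) gap
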